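{- Let $\pi,\beta\in\mathbb{E}$ with $\beta$ a pure quaternion and $p=N(\pi)>2$ a prime in $\mathbb{Z}$. Then $\pi\beta\pi^{ -1}\in\mathbb{E}$ if and only if there exists an integer $h\in\mathbb{Z}$ such that $\overline{\pi}$ divides $h+\beta$ on the left, i.e. $h+\beta=\overline{\pi}\tau$ for some $\tau\in\mathbb{E}$.
   Context: $\mathbb{E}$ denotes the ring of Hurwitz integral quaternions: quaternions $a+bi+cj+dk$ where either $a,b,c,d$ are all integers or all are halves of odd integers. For $\alpha=a+bi+cj+dk$: $\overline{\alpha}=a-bi-cj-dk$, $N(\alpha)=a^2+b^2+c^2+d^2$; $\alpha$ is pure if $a=0$. -}

module Defs where

open import Data.Integer.Base using (ℤ; +_)
open import Data.Rational.Base using (ℚ; 0ℚ; 1ℚ; ½; _+_; _-_; _*_; -_; 1/_; _/_; ≢-nonZero)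
open import Data.Rational.Properties using (_≟_)
open import Data.Nat.Base using (ℕ)
open import Data.Nat.Primality using (Prime)
open import Data.Product using (Σ; ∃; _×_)
open import Data.Sum using (_⊎_)
open import Relation.Nullary using (yes; no)
open import Relation.Binary.PropositionalEquality using (_≡_)

record Quat : Set where
  constructor quat
  field
    re ii jj kk : ℚ
open Quat public

ofℚ : ℚ → Quat
ofℚ x = quat x 0ℚ 0ℚ 0ℚ

ofℤ : ℤ → Quat
ofℤ z = ofℚ (z / 1)

infixl 6 _⊕_
infixl 7 _⊗_

_⊕_ : Quat → Quat → Quat
quat a b c d ⊕ quat e f g h = quat (a + e) (b + f) (c + g) (d + h)

-- Hamilton product (i² = j² = k² = ijk = -1)
_⊗_ : Quat → Quat → Quat
quat a₁ b₁ c₁ d₁ ⊗ quat a₂ b₂ c₂ d₂ = quat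
  (a₁ * a₂ - b₁ * b₂ - c₁ * c₂ - d₁ * d₂)
  (a₁ * b₂ + b₁ * a₂ + c₁ * d₂ - d₁ * c₂)
  (a₁ * c₂ - b₁ * d₂ + c₁ * a₂ + d₁ * b₂)
  (a₁ * d₂ + b₁ * c₂ - c₁ * b₂ + d₁ * a₂)

conj : Quat → Quat
conj (quat a b c d) = quat a (- b) (- c) (- d)

norm : Quat → ℚ
norm (quat a b c d) = a * a + b * b + c * c + d * d

scale : ℚ → Quat → Quat
scale r (quat a b c d) = quat (r * a) (r * b) (r * c) (r * d)

-- multiplicative inverse  q⁻¹ = conj q / N(q)  (junk value 0 when q = 0)
inv : Quat → Quat
inv q with norm q ≟ 0ℚ
... | yes _ = quat 0ℚ 0ℚ 0ℚ 0ℚ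
... | no n≢0 = scale (1/_ (norm q) {{≢-nonZero n≢0}}) (conj q)

IsInt : ℚ → Set
IsInt x = ∃ λ (z : ℤ) → x ≡ z / 1

IsHalfOdd : ℚ → Set
IsHalfOdd x = IsInt (x - ½)

IsHurwitz : Quat → Set
IsHurwitz (quat a b c d) =
  (IsInt a × IsInt b × IsInt c × IsInt d) ⊎
  (IsHalfOdd a × IsHalfOdd b × IsHalfOdd c × IsHalfOdd d)

Pure : Quat → Set
Pure q = re q ≡ 0ℚ

{-# OPTIONS --safe #-}

-- Write the Hurwitz order 𝔼 in its ℤ-basis ω = (1 + i + j + k)/2, i, j, k, so that
-- π β π⁻¹ ∈ 𝔼 means p ∣ π β π̄ and π̄ ∣ h + β means p ∣ π (h + β), as π̄ π = p.
-- If h + β = π̄ τ then π β π⁻¹ = τ π̄ - h.  Conversely, for every e ∈ 𝔼,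
--   tr (e π) · π β = tr (β e π) · π - p · (β e)‾ + π β π̄ · ē,
-- so modulo p the integer t = tr (e π) turns π β into a multiple of π.  The traces of
-- π, i π, j π, k π have squares summing to 4p, so one of them is prime to the odd prime p,
-- and h = - t⁻¹ tr (β e π) mod p makes π (h + β) divisible by p.
module Submission where

open import Defs
open import Data.Nat.Base using (ℕ; _>_)
open import Data.Nat.Primality using (Prime)
open import Data.Integer.Base using (ℤ; +_)
open import Data.Rational.Base using (_/_)
open import Data.Product using (∃; _×_; _,_)
open import Function.Bundles using (_⇔_)
open import Relation.Binary.PropositionalEquality using (_≡_)

open import Level using (0ℓ)
open import Algebra.Bundles.Raw using (RawRing)
import Algebra.Definitions.RawSemiring as RawSemiringDefinitions
open import Data.Empty using (⊥; ⊥-elim)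
open import Data.Sum using (_⊎_; inj₁; inj₂)
open import Data.Vec.Base using (Vec; []; _∷_; map; allFin)
open import Data.Vec.Properties using (lookup-map)
open import Function.Base using (id)
open import Function.Bundles using (mk⇔)
import Function.Properties.Equivalence as ⇔
open import Relation.Binary.PropositionalEquality
  using (refl; sym; trans; cong; cong₂; subst; _≢_; module ≡-Reasoning)
open import Relation.Nullary using (yes; no; contradiction)
open import Relation.Nullary.Decidable using (dec⇒maybe)

import Data.Nat.Base as ℕ
import Data.Nat.Properties as ℕ
import Data.Nat.Divisibility as ℕ
open import Data.Nat.Primality using (prime⇒irreducible; prime⇒nonZero; euclidsLemma)
open import Data.Nat.Coprimality using (Coprime; coprime-Bézout)
import Data.Nat.Coprimality as Coprimality
open import Data.Nat.GCD using (module Bézout)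
import Data.Integer.Base as ℤ
import Data.Integer.Properties as ℤ
open import Data.Integer.DivMod using (a≡a%ℕn+[a/ℕn]*n; n%ℕd<d)
open import Data.Integer.Divisibility.Signed using (_∣_; divides; ∣ᵤ⇒∣; ∣⇒∣ᵤ; m∣∣m∣)
import Data.Integer.Tactic.RingSolver as ℤ-Solver
open import Data.Rational.Base as ℚ using (ℚ; 0ℚ; 1ℚ; ½; 1/_; ≢-nonZero)
import Data.Rational.Properties as ℚ
import Tactic.RingSolver as RingSolver
open import Tactic.RingSolver.Core.AlmostCommutativeRing
  using (AlmostCommutativeRing; fromCommutativeRing)
open import Tactic.RingSolver.Core.Expression as Expression using (Expr; Κ; Ι; _⊛_; ⊝_; module Eval)
import Tactic.RingSolver.NonReflective as NonReflective

record Coords (A : Set) : Set where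
  constructor ⟨_,_,_,_⟩
  field c₀ c₁ c₂ c₃ : A
open Coords

cong₄ : ∀ {A B : Set} (f : A → A → A → A → B) {a b c d a′ b′ c′ d′} →
  a ≡ a′ → b ≡ b′ → c ≡ c′ → d ≡ d′ → f a b c d ≡ f a′ b′ c′ d′
cong₄ f refl refl refl refl = refl

map⁴ : ∀ {A B : Set} → (A → B) → Coords A → Coords B
map⁴ f ⟨ a , b , c , d ⟩ = ⟨ f a , f b , f c , f d ⟩

module Formulas (R : RawRing 0ℓ 0ℓ) where
  open RawRing R using () renaming (Carrier to A)
  open RawRing R public using (_+_; _*_; -_; 0#; 1#)

  infixl 6 _⊹_
  infixl 7 _∙_ _·_ _⋆_

  two : A
  two = 1# + 1#

  _⊹_ : Coords A → Coords A → Coords A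
  ⟨ a , b , c , d ⟩ ⊹ ⟨ e , f , g , h ⟩ = ⟨ a + e , b + f , c + g , d + h ⟩

  _∙_ : A → Coords A → Coords A
  s ∙ ⟨ a , b , c , d ⟩ = ⟨ s * a , s * b , s * c , s * d ⟩

  -- Coordinates with respect to 1, i, j, k.

  _⋆_ : Coords A → Coords A → Coords A
  ⟨ a₁ , b₁ , c₁ , d₁ ⟩ ⋆ ⟨ a₂ , b₂ , c₂ , d₂ ⟩ = ⟨
    a₁ * a₂ + - (b₁ * b₂) + - (c₁ * c₂) + - (d₁ * d₂) ,
    a₁ * b₂ + b₁ * a₂ + c₁ * d₂ + - (d₁ * c₂) ,
    a₁ * c₂ + - (b₁ * d₂) + c₁ * a₂ + d₁ * b₂ ,
    a₁ * d₂ + b₁ * c₂ + - (c₁ * b₂) + d₁ * a₂ ⟩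

  conjᴴ : Coords A → Coords A
  conjᴴ ⟨ a , b , c , d ⟩ = ⟨ a , - b , - c , - d ⟩

  normᴴ : Coords A → A
  normᴴ ⟨ a , b , c , d ⟩ = a * a + b * b + c * c + d * d

  -- Coordinates with respect to ω = (1 + i + j + k)/2, i, j, k, a ℤ-basis of
  -- the Hurwitz order; the product expands (a ω + b i + c j + d k)(e ω + f i + g j + h k)
  -- with ω² = - ω + i + j + k, ω i = - ω + i + j, i ω = - ω + i + k, and cyclically.

  _·_ : Coords A → Coords A → Coords A
  ⟨ a , b , c , d ⟩ · ⟨ e , f , g , h ⟩ = ⟨
    - (a * (e + f + g + h) + e * (b + c + d) + two * (b * f + c * g + d * h)) ,
    a * (e + f + h) + e * (b + c) + b * f + c * g + c * h + - (d * g) + d * h ,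
    a * (e + f + g) + e * (c + d) + b * f + - (b * h) + c * g + d * f + d * h ,
    a * (e + g + h) + e * (b + d) + b * f + b * g + - (c * f) + c * g + d * h ⟩

  bar : Coords A → Coords A
  bar ⟨ a , b , c , d ⟩ = ⟨ a , - a + - b , - a + - c , - a + - d ⟩

  nrm : Coords A → A
  nrm ⟨ a , b , c , d ⟩ = a * (a + b + c + d) + b * b + c * c + d * d

  tr : Coords A → A
  tr = c₀

  real : A → Coords A
  real s = ⟨ two * s , - s , - s , - s ⟩

  ω 𝕚 𝕛 𝕜 : Coords A
  ω = ⟨ 1# , 0# , 0# , 0# ⟩
  𝕚 = ⟨ 0# , 1# , 0# , 0# ⟩
  𝕛 = ⟨ 0# , 0# , 1# , 0# ⟩
  𝕜 = ⟨ 0# , 0# , 0# , 1# ⟩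

  -- The first argument is ½, which a general ring lacks.
  toHamilton : A → Coords A → Coords A
  toHamilton half ⟨ a , b , c , d ⟩ = ⟨ half * a , half * a + b , half * a + c , half * a + d ⟩

  fromHamilton : Coords A → Coords A
  fromHamilton ⟨ x₀ , x₁ , x₂ , x₃ ⟩ = ⟨ two * x₀ , x₁ + - x₀ , x₂ + - x₀ , x₃ + - x₀ ⟩

module CoordinateSolver (R : AlmostCommutativeRing 0ℓ 0ℓ)
  (≈⇒≡ : ∀ {x y} → AlmostCommutativeRing._≈_ R x y → x ≡ y) where

  open AlmostCommutativeRing R using (Carrier; _≈_; rawRing) renaming (refl to ≈-refl)
  open NonReflective R using (module Ops)
  open Ops using (⟦_⇓⟧; prove)
  open Ops public using (⟦_⟧)
  open RawRing rawRing using (0#; 1#)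

  exprRawRing : ℕ → RawRing 0ℓ 0ℓ
  exprRawRing n = record
    { Carrier = Expr Carrier n ; _≈_ = _≡_
    ; _+_ = Expression._⊕_ ; _*_ = Expression._⊗_ ; -_ = ⊝_ ; 0# = Κ 0# ; 1# = Κ 1# }

  Curried : ℕ → Set → Set → Set
  Curried ℕ.zero A B = B
  Curried (ℕ.suc n) A B = A → Curried n A B

  _$ⁿ_ : ∀ {n A B} → Curried n A B → Vec A n → B
  f $ⁿ [] = f
  f $ⁿ (x ∷ xs) = f x $ⁿ xs

  -- Expressions in k quaternion variables followed by m scalar variables.
  Term : ℕ → ℕ → Set
  Term k m = Expr Carrier (k ℕ.* 4 ℕ.+ m)

  Form : ℕ → ℕ → Set → Set
  Form k m B = Curried k (Coords (Term k m)) (Curried m (Term k m) B)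

  split : ∀ k {m} {A : Set} → Vec A (k ℕ.* 4 ℕ.+ m) → Vec (Coords A) k × Vec A m
  split ℕ.zero xs = [] , xs
  split (ℕ.suc k) (a ∷ b ∷ c ∷ d ∷ xs) with split k xs
  ... | qs , ys = ⟨ a , b , c , d ⟩ ∷ qs , ys

  flatten : ∀ {k m} {A : Set} → Vec (Coords A) k → Vec A m → Vec A (k ℕ.* 4 ℕ.+ m)
  flatten [] ys = ys
  flatten (⟨ a , b , c , d ⟩ ∷ qs) ys = a ∷ b ∷ c ∷ d ∷ flatten qs ys

  instantiate : ∀ k m {B} → Form k m B → B
  instantiate k m f with split k (map Ι (allFin (k ℕ.* 4 ℕ.+ m)))
  ... | qs , ys = (f $ⁿ qs) $ⁿ ys

  eval : ∀ {n} → Coords (Expr Carrier n) → Vec Carrier n → Coords Carrier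
  eval E ρ = map⁴ (λ e → ⟦ e ⟧ ρ) E

  normal : ∀ {n} → Coords (Expr Carrier n) → Vec Carrier n → Coords Carrier
  normal E ρ = map⁴ (λ e → ⟦ e ⇓⟧ ρ) E

  ≡⇒≈ : ∀ {x y} → x ≡ y → x ≈ y
  ≡⇒≈ refl = ≈-refl

  solve : ∀ k m (f : Form k m (Coords (Term k m) × Coords (Term k m)))
    (qs : Vec (Coords Carrier) k) (ys : Vec Carrier m) →
    let ρ = flatten qs ys ; (l , r) = instantiate k m f in
    normal l ρ ≡ normal r ρ → eval l ρ ≡ eval r ρ
  solve k m f qs ys eq with instantiate k m f
  ... | ⟨ a , b , c , d ⟩ , ⟨ e , f′ , g , h ⟩ = cong₄ ⟨_,_,_,_⟩
    (≈⇒≡ (prove ρ a e (≡⇒≈ (cong c₀ eq)))) (≈⇒≡ (prove ρ b f′ (≡⇒≈ (cong c₁ eq))))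
    (≈⇒≡ (prove ρ c g (≡⇒≈ (cong c₂ eq)))) (≈⇒≡ (prove ρ d h (≡⇒≈ (cong c₃ eq))))
    where ρ = flatten qs ys

  solve₁ : ∀ k m (f : Form k m (Term k m × Term k m))
    (qs : Vec (Coords Carrier) k) (ys : Vec Carrier m) →
    let ρ = flatten qs ys ; (l , r) = instantiate k m f in
    ⟦ l ⇓⟧ ρ ≡ ⟦ r ⇓⟧ ρ → ⟦ l ⟧ ρ ≡ ⟦ r ⟧ ρ
  solve₁ k m f qs ys eq with instantiate k m f
  ... | l , r = ≈⇒≡ (prove (flatten qs ys) l r (≡⇒≈ eq))

-- The Hurwitz order in coordinates

open import Data.Integer.Base using (_+_; _*_; _-_; -_; 0ℤ; 1ℤ)

𝔼 : Set
𝔼 = Coords ℤ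

open Formulas ℤ.+-*-rawRing hiding (_+_; _*_; -_; 0#; 1#)
module ℤS = CoordinateSolver ℤ-Solver.ring id
module E {n} = Formulas (ℤS.exprRawRing n)

·-assoc : ∀ X Y Z → X · Y · Z ≡ X · (Y · Z)
·-assoc X Y Z = ℤS.solve 3 0 (λ X Y Z → X E.· Y E.· Z , X E.· (Y E.· Z)) (X ∷ Y ∷ Z ∷ []) [] refl

bar-· : ∀ X Y → bar (X · Y) ≡ bar Y · bar X
bar-· X Y = ℤS.solve 2 0 (λ X Y → E.bar (X E.· Y) , E.bar Y E.· E.bar X) (X ∷ Y ∷ []) [] refl

·-⊹-·-bar : ∀ X Y → X · Y ⊹ X · bar Y ≡ tr Y ∙ X
·-⊹-·-bar X Y = ℤS.solve 2 0 (λ X Y → X E.· Y E.⊹ X E.· E.bar Y , E.tr Y E.∙ X)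
  (X ∷ Y ∷ []) [] refl

sandwich : ∀ P X → P · (X · P) ≡ tr (X · P) ∙ P ⊹ - nrm P ∙ bar X
sandwich P X = ℤS.solve 2 0
  (λ P X → P E.· (X E.· P) , E.tr (X E.· P) E.∙ P E.⊹ E.- E.nrm P E.∙ E.bar X) (P ∷ X ∷ []) [] refl

bar-·-· : ∀ P Y → bar P · (P · Y) ≡ nrm P ∙ Y
bar-·-· P Y = ℤS.solve 2 0 (λ P Y → E.bar P E.· (P E.· Y) , E.nrm P E.∙ Y) (P ∷ Y ∷ []) [] refl

·-∙ : ∀ n X Y → X · (n ∙ Y) ≡ n ∙ (X · Y)
·-∙ n X Y = ℤS.solve 2 1 (λ X Y n → X E.· (n E.∙ Y) , n E.∙ (X E.· Y))
  (X ∷ Y ∷ []) (n ∷ []) refl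

·-real-⊹ : ∀ h P B → P · (real h ⊹ B) ≡ h ∙ P ⊹ P · B
·-real-⊹ h P B = ℤS.solve 2 1 (λ P B h → P E.· (E.real h E.⊹ B) , h E.∙ P E.⊹ P E.· B)
  (P ∷ B ∷ []) (h ∷ []) refl

real-⊹-real-neg : ∀ h B → real h ⊹ B ⊹ real (- h) ≡ B
real-⊹-real-neg h B = ℤS.solve 1 1 (λ B h → E.real h E.⊹ B E.⊹ E.real (E.- h) , B)
  (B ∷ []) (h ∷ []) refl

bar-sandwich : ∀ P T c → P · (bar P · T ⊹ real c) · bar P ≡ nrm P ∙ (T · bar P ⊹ real c)
bar-sandwich P T c = ℤS.solve 2 1
  (λ P T c → P E.· (E.bar P E.· T E.⊹ E.real c) E.· E.bar P , E.nrm P E.∙ (T E.· E.bar P E.⊹ E.real c))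
  (P ∷ T ∷ []) (c ∷ []) refl

-- Up to sign, these traces are the coordinates of 2P with respect to 1, i, j, k.
trace-square-sum : ∀ P →
  tr (real 1ℤ · P) * tr (real 1ℤ · P) + tr (𝕚 · P) * tr (𝕚 · P)
    + tr (𝕛 · P) * tr (𝕛 · P) + tr (𝕜 · P) * tr (𝕜 · P) ≡ + 4 * nrm P
trace-square-sum P = ℤS.solve₁ 1 0 (λ P →
  let t = λ U → E.tr (U E.· P) in
  t (E.real E.1#) E.* t (E.real E.1#) E.+ t E.𝕚 E.* t E.𝕚 E.+ t E.𝕛 E.* t E.𝕛 E.+ t E.𝕜 E.* t E.𝕜 ,
  Κ (+ 4) E.* E.nrm P) (P ∷ []) [] refl

-- Divisibility by a prime

ℕ-identity-in-ℤ : ∀ a b c d → 1 ℕ.+ a ℕ.* b ≡ c ℕ.* d → 1ℤ + + a * + b ≡ + c * + d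
ℕ-identity-in-ℤ a b c d eq = begin
  1ℤ + + a * + b     ≡⟨ cong (λ z → 1ℤ + z) (ℤ.pos-* a b) ⟨
  1ℤ + + (a ℕ.* b)   ≡⟨ ℤ.pos-+ 1 (a ℕ.* b) ⟨
  + (1 ℕ.+ a ℕ.* b)  ≡⟨ cong +_ eq ⟩
  + (c ℕ.* d)        ≡⟨ ℤ.pos-* c d ⟩
  + c * + d          ∎
  where open ≡-Reasoning

bézout-inverse : ∀ {p n} → Bézout.Identity 1 p n → ∃ λ u → + p ∣ u * + n - 1ℤ
bézout-inverse {p} {n} (Bézout.+- x y eq) = - + y , divides (- + x) (begin
  - + y * + n - 1ℤ    ≡⟨ negate (+ y) (+ n) ⟩
  - (1ℤ + + y * + n)  ≡⟨ cong -_ (ℕ-identity-in-ℤ y n x p eq) ⟩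
  - (+ x * + p)       ≡⟨ ℤ.neg-distribˡ-* (+ x) (+ p) ⟩
  - + x * + p         ∎)
  where
  open ≡-Reasoning
  negate : ∀ y n → - y * n - 1ℤ ≡ - (1ℤ + y * n)
  negate = ℤ-Solver.solve-∀
bézout-inverse {p} {n} (Bézout.-+ x y eq) = + y , divides (+ x) (begin
  + y * + n - 1ℤ       ≡⟨ cong (_- 1ℤ) (ℕ-identity-in-ℤ x p y n eq) ⟨
  1ℤ + + x * + p - 1ℤ  ≡⟨ cancel (+ x * + p) ⟩
  + x * + p            ∎)
  where
  open ≡-Reasoning
  cancel : ∀ z → 1ℤ + z - 1ℤ ≡ z
  cancel = ℤ-Solver.solve-∀

divisible-or-invertible : ∀ {p} → Prime p → ∀ c → + p ∣ c ⊎ ∃ λ u → + p ∣ u * c - 1ℤ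
divisible-or-invertible {p} p-prime c with p ℕ.∣? ℤ.∣ c ∣
... | yes p∣c = inj₁ (∣ᵤ⇒∣ p∣c)
... | no p∤c = inj₂ (unsign (bézout-inverse (coprime-Bézout coprime)))
  where
  coprime : Coprime p ℤ.∣ c ∣
  coprime (d∣p , d∣c) with prime⇒irreducible p-prime d∣p
  ... | inj₁ d≡1 = d≡1
  ... | inj₂ refl = contradiction d∣c p∤c
  unsign : (∃ λ u → + p ∣ u * + ℤ.∣ c ∣ - 1ℤ) → ∃ λ u → + p ∣ u * c - 1ℤ
  unsign (u , p∣) with m∣∣m∣ {c}
  ... | divides s ∣c∣≡sc = u * s ,
    subst (λ z → + p ∣ z - 1ℤ) (trans (cong (u *_) ∣c∣≡sc) (sym (ℤ.*-assoc u s c))) p∣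

-- p² would divide a² + b² + c² + d² = 4p, so p ∣ 4.
odd-prime-not-dividing-all : ∀ {p} → Prime p → 2 ℕ.< p → ∀ {a b c d} →
  a * a + b * b + c * c + d * d ≡ + 4 * + p →
  + p ∣ a → + p ∣ b → + p ∣ c → + p ∣ d → ⊥
odd-prime-not-dividing-all {p} p-prime 2<p sum≡4p
  (divides qa refl) (divides qb refl) (divides qc refl) (divides qd refl) =
  ℕ.<⇒≱ 2<p (ℕ.∣⇒≤ p∣2)
  where
  instance _ = prime⇒nonZero p-prime
  Q = qa * qa + qb * qb + qc * qc + qd * qd
  factor : ∀ a b c d p → (a * p) * (a * p) + (b * p) * (b * p)
      + (c * p) * (c * p) + (d * p) * (d * p)
    ≡ (a * a + b * b + c * c + d * d) * p * p
  factor = ℤ-Solver.solve-∀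
  4≡Qp : + 4 ≡ Q * + p
  4≡Qp = sym (ℤ.*-cancelʳ-≡ (Q * + p) (+ 4) (+ p) (trans (sym (factor qa qb qc qd (+ p))) sum≡4p))
  p∣2 : p ℕ.∣ 2
  p∣2 with euclidsLemma 2 2 p-prime (∣⇒∣ᵤ (divides Q 4≡Qp))
  ... | inj₁ p∣2 = p∣2
  ... | inj₂ p∣2 = p∣2

-- Conjugation by an element of prime norm

trace-identity : ∀ P B e →
  tr (e · P) ∙ (P · B) ≡ tr (B · e · P) ∙ P ⊹ - nrm P ∙ bar (B · e) ⊹ P · B · bar P · bar e
trace-identity P B e = begin
  tr (e · P) ∙ (P · B)
    ≡⟨ ·-⊹-·-bar (P · B) (e · P) ⟨
  P · B · (e · P) ⊹ P · B · bar (e · P)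
    ≡⟨ cong₂ _⊹_ regroup (cong (P · B ·_) (bar-· e P)) ⟩
  P · (B · e · P) ⊹ P · B · (bar P · bar e)
    ≡⟨ cong₂ _⊹_ (sandwich P (B · e)) (sym (·-assoc (P · B) (bar P) (bar e))) ⟩
  tr (B · e · P) ∙ P ⊹ - nrm P ∙ bar (B · e) ⊹ P · B · bar P · bar e
    ∎
  where
  open ≡-Reasoning
  regroup : P · B · (e · P) ≡ P · (B · e · P)
  regroup = trans (·-assoc P B (e · P)) (cong (P ·_) (sym (·-assoc B e P)))

trace-congruence : ∀ {p} P B G e → nrm P ≡ + p → P · B · bar P ≡ + p ∙ G →
  tr (e · P) ∙ (P · B) ≡ tr (B · e · P) ∙ P ⊹ + p ∙ (G · bar e ⊹ - 1ℤ ∙ bar (B · e))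
trace-congruence {p} P B G e N≡p PBP̄≡pG = begin
  tr (e · P) ∙ (P · B)
    ≡⟨ trace-identity P B e ⟩
  s ∙ P ⊹ - nrm P ∙ C ⊹ P · B · bar P · bar e
    ≡⟨ cong₂ (λ n M → s ∙ P ⊹ - n ∙ C ⊹ M · bar e) N≡p PBP̄≡pG ⟩
  s ∙ P ⊹ - + p ∙ C ⊹ + p ∙ G · bar e
    ≡⟨ regroup ⟩
  s ∙ P ⊹ + p ∙ (G · bar e ⊹ - 1ℤ ∙ C)
    ∎
  where
  open ≡-Reasoning
  s = tr (B · e · P)
  C = bar (B · e)
  regroup = ℤS.solve 4 2
    (λ P C G e s p → s E.∙ P E.⊹ E.- p E.∙ C E.⊹ p E.∙ G E.· E.bar e ,
                     s E.∙ P E.⊹ p E.∙ (G E.· E.bar e E.⊹ E.- E.1# E.∙ C))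
    (P ∷ C ∷ G ∷ e ∷ []) (s ∷ + p ∷ []) refl

cancel-unit : ∀ p t u m s x y w → u * t - 1ℤ ≡ m * p → t * x ≡ s * y + p * w →
  - (u * s) * y + x ≡ p * (u * w + - m * x)
cancel-unit p t u m s x y w ut-1≡mp tx≡sy+pw = begin
  - (u * s) * y + x
    ≡⟨ expand u t s x y ⟩
  u * (t * x) - u * s * y - (u * t - 1ℤ) * x
    ≡⟨ cong₂ (λ a b → u * a - u * s * y - b * x) tx≡sy+pw ut-1≡mp ⟩
  u * (s * y + p * w) - u * s * y - m * p * x
    ≡⟨ collect u s y p w m x ⟩
  p * (u * w + - m * x)
    ∎
  where
  open ≡-Reasoning
  expand : ∀ u t s x y → - (u * s) * y + x ≡ u * (t * x) - u * s * y - (u * t - 1ℤ) * x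
  expand = ℤ-Solver.solve-∀
  collect : ∀ u s y p w m x → u * (s * y + p * w) - u * s * y - m * p * x ≡ p * (u * w + - m * x)
  collect = ℤ-Solver.solve-∀

cancel-unit⁴ : ∀ p t u m s X Y W → u * t - 1ℤ ≡ m * p → t ∙ X ≡ s ∙ Y ⊹ p ∙ W →
  - (u * s) ∙ Y ⊹ X ≡ p ∙ (u ∙ W ⊹ - m ∙ X)
cancel-unit⁴ p t u m s ⟨ x₀ , x₁ , x₂ , x₃ ⟩ ⟨ y₀ , y₁ , y₂ , y₃ ⟩ ⟨ w₀ , w₁ , w₂ , w₃ ⟩
  ut-1≡mp tX≡sY+pW = cong₄ ⟨_,_,_,_⟩
    (cancel x₀ y₀ w₀ (cong c₀ tX≡sY+pW)) (cancel x₁ y₁ w₁ (cong c₁ tX≡sY+pW))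
    (cancel x₂ y₂ w₂ (cong c₂ tX≡sY+pW)) (cancel x₃ y₃ w₃ (cong c₃ tX≡sY+pW))
  where
  cancel : ∀ x y w → t * x ≡ s * y + p * w → - (u * s) * y + x ≡ p * (u * w + - m * x)
  cancel x y w = cancel-unit p t u m s x y w ut-1≡mp

∙-cancelˡ : ∀ n .{{_ : ℤ.NonZero n}} X Y → n ∙ X ≡ n ∙ Y → X ≡ Y
∙-cancelˡ n ⟨ _ , _ , _ , _ ⟩ ⟨ _ , _ , _ , _ ⟩ nX≡nY = cong₄ ⟨_,_,_,_⟩
  (ℤ.*-cancelˡ-≡ n _ _ (cong c₀ nX≡nY)) (ℤ.*-cancelˡ-≡ n _ _ (cong c₁ nX≡nY))
  (ℤ.*-cancelˡ-≡ n _ _ (cong c₂ nX≡nY)) (ℤ.*-cancelˡ-≡ n _ _ (cong c₃ nX≡nY))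

invertible-trace : ∀ {p} P → Prime p → 2 ℕ.< p → nrm P ≡ + p →
  ∃ λ e → ∃ λ u → + p ∣ u * tr (e · P) - 1ℤ
invertible-trace {p} P p-prime 2<p N≡p
  with divisible-or-invertible p-prime (tr (real 1ℤ · P)) | divisible-or-invertible p-prime (tr (𝕚 · P))
     | divisible-or-invertible p-prime (tr (𝕛 · P)) | divisible-or-invertible p-prime (tr (𝕜 · P))
... | inj₂ inv | _ | _ | _ = real 1ℤ , inv
... | inj₁ _ | inj₂ inv | _ | _ = 𝕚 , inv
... | inj₁ _ | inj₁ _ | inj₂ inv | _ = 𝕛 , inv
... | inj₁ _ | inj₁ _ | inj₁ _ | inj₂ inv = 𝕜 , inv
... | inj₁ d₀ | inj₁ d₁ | inj₁ d₂ | inj₁ d₃ = ⊥-elim (odd-prime-not-dividing-all p-prime 2<p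
  (trans (trace-square-sum P) (cong (λ n → + 4 * n) N≡p)) d₀ d₁ d₂ d₃)

divisible-conjugate⇒left-divisor : ∀ {p} P B G → Prime p → 2 ℕ.< p → nrm P ≡ + p →
  P · B · bar P ≡ + p ∙ G → ∃ λ h → ∃ λ T → real h ⊹ B ≡ bar P · T
divisible-conjugate⇒left-divisor {p} P B G p-prime 2<p N≡p PBP̄≡pG
  with invertible-trace P p-prime 2<p N≡p
... | e , u , divides m ut-1≡mp = h , T , ∙-cancelˡ (+ p) _ _ (begin
  + p ∙ (real h ⊹ B)          ≡⟨ cong (_∙ (real h ⊹ B)) N≡p ⟨
  nrm P ∙ (real h ⊹ B)        ≡⟨ bar-·-· P (real h ⊹ B) ⟨
  bar P · (P · (real h ⊹ B))  ≡⟨ cong (bar P ·_) (·-real-⊹ h P B) ⟩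
  bar P · (h ∙ P ⊹ P · B)     ≡⟨ cong (bar P ·_) hP+PB≡pT ⟩
  bar P · (+ p ∙ T)           ≡⟨ ·-∙ (+ p) (bar P) T ⟩
  + p ∙ (bar P · T)           ∎)
  where
  open ≡-Reasoning
  instance _ = prime⇒nonZero p-prime
  t = tr (e · P)
  s = tr (B · e · P)
  W = G · bar e ⊹ - 1ℤ ∙ bar (B · e)
  h = - (u * s)
  T = u ∙ W ⊹ - m ∙ (P · B)
  tPB≡sP+pW : t ∙ (P · B) ≡ s ∙ P ⊹ + p ∙ W
  tPB≡sP+pW = trace-congruence P B G e N≡p PBP̄≡pG
  hP+PB≡pT : h ∙ P ⊹ P · B ≡ + p ∙ T
  hP+PB≡pT = cancel-unit⁴ (+ p) t u m s (P · B) P W ut-1≡mp tPB≡sP+pW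

left-divisor⇒divisible-conjugate : ∀ h B P T → real h ⊹ B ≡ bar P · T →
  P · B · bar P ≡ nrm P ∙ (T · bar P ⊹ real (- h))
left-divisor⇒divisible-conjugate h B P T h+B≡P̄T = begin
  P · B · bar P                         ≡⟨ cong (λ X → P · X · bar P) B≡P̄T-h ⟩
  P · (bar P · T ⊹ real (- h)) · bar P  ≡⟨ bar-sandwich P T (- h) ⟩
  nrm P ∙ (T · bar P ⊹ real (- h))      ∎
  where
  open ≡-Reasoning
  B≡P̄T-h : B ≡ bar P · T ⊹ real (- h)
  B≡P̄T-h = trans (sym (real-⊹-real-neg h B)) (cong (_⊹ real (- h)) h+B≡P̄T)

divisible-conjugate⇔left-divisor : ∀ {p} P B → Prime p → 2 ℕ.< p → nrm P ≡ + p →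
  (∃ λ G → P · B · bar P ≡ + p ∙ G) ⇔ (∃ λ h → ∃ λ T → real h ⊹ B ≡ bar P · T)
divisible-conjugate⇔left-divisor P B p-prime 2<p N≡p = mk⇔
  (λ (G , PBP̄≡pG) → divisible-conjugate⇒left-divisor P B G p-prime 2<p N≡p PBP̄≡pG)
  (λ (h , T , h+B≡P̄T) → T · bar P ⊹ real (- h) ,
     trans (left-divisor⇒divisible-conjugate h B P T h+B≡P̄T) (cong (_∙ (T · bar P ⊹ real (- h))) N≡p))

ι : ℤ → ℚ
ι z = z / 1

-- ℚ has no η-rule, so arithmetic on z / 1 only computes once it is put in constructor form.
ι≡mkℚ : ∀ z → ι z ≡ ℚ.mkℚ z 0 (Coprimality.sym (Coprimality.1-coprimeTo ℤ.∣ z ∣))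
ι≡mkℚ z = ℚ.↥p/↧p≡p (ℚ.mkℚ z 0 (Coprimality.sym (Coprimality.1-coprimeTo ℤ.∣ z ∣)))

ι-injective : ∀ {a b} → ι a ≡ ι b → a ≡ b
ι-injective {a} {b} ιa≡ιb = cong ℚ.↥_ (trans (sym (ι≡mkℚ a)) (trans ιa≡ιb (ι≡mkℚ b)))

ι-* : ∀ a b → ι (a * b) ≡ ι a ℚ.* ι b
ι-* a b = sym (cong₂ ℚ._*_ (ι≡mkℚ a) (ι≡mkℚ b))

ι-+ : ∀ a b → ι (a + b) ≡ ι a ℚ.+ ι b
ι-+ a b = trans (cong ι (sym (unit a b))) (sym (cong₂ ℚ._+_ (ι≡mkℚ a) (ι≡mkℚ b)))
  where
  unit : ∀ a b → a * + 1 + b * + 1 ≡ a + b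
  unit = ℤ-Solver.solve-∀

ℚ-ring : AlmostCommutativeRing 0ℓ 0ℓ
ℚ-ring = fromCommutativeRing ℚ.+-*-commutativeRing (λ x → dec⇒maybe (0ℚ ℚ.≟ x))

ι-neg : ∀ a → ι (- a) ≡ ℚ.- ι a
ι-neg a = begin
  ι (- a)                    ≡⟨ add-sub (ι (- a)) (ι a) ⟩
  ι (- a) ℚ.+ ι a ℚ.- ι a    ≡⟨ cong (ℚ._- ι a) (ι-+ (- a) a) ⟨
  ι (- a + a) ℚ.- ι a        ≡⟨ cong (λ z → ι z ℚ.- ι a) (ℤ.+-inverseˡ a) ⟩
  0ℚ ℚ.- ι a                 ≡⟨ zero-sub (ι a) ⟩
  ℚ.- ι a                    ∎
  where
  open ≡-Reasoning
  add-sub : ∀ x y → x ≡ x ℚ.+ y ℚ.- y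
  add-sub = RingSolver.solve-∀ ℚ-ring
  zero-sub : ∀ y → 0ℚ ℚ.- y ≡ ℚ.- y
  zero-sub = RingSolver.solve-∀ ℚ-ring

module ℚS = CoordinateSolver ℚ-ring id
module Eℚ {n} = Formulas (ℚS.exprRawRing n)
module Q = Formulas ℚ.+-*-rawRing

module _ where
  open Eval ℚ.+-*-rawRing ι renaming (⟦_⟧ to ℚ⟦_⟧)
  open RawSemiringDefinitions (RawRing.rawSemiring (AlmostCommutativeRing.rawRing ℤ-Solver.ring))
    using () renaming (_^′_ to _^ℤ_)
  open RawSemiringDefinitions (RawRing.rawSemiring ℚ.+-*-rawRing) using () renaming (_^′_ to _^ℚ_)

  ι-^ : ∀ x n → ι (x ^ℤ n) ≡ ι x ^ℚ n
  ι-^ x ℕ.zero = refl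
  ι-^ x (ℕ.suc ℕ.zero) = refl
  ι-^ x (ℕ.suc (ℕ.suc n)) = trans (ι-* (x ^ℤ ℕ.suc n) x) (cong (ℚ._* ι x) (ι-^ x (ℕ.suc n)))

  ι-⟦⟧ : ∀ {n} (e : Expr ℤ n) ρ → ι (ℤS.⟦ e ⟧ ρ) ≡ ℚ⟦ e ⟧ (map ι ρ)
  ι-⟦⟧ (Κ c) ρ = refl
  ι-⟦⟧ (Ι i) ρ = sym (lookup-map i ι ρ)
  ι-⟦⟧ (e Expression.⊕ e′) ρ =
    trans (ι-+ (ℤS.⟦ e ⟧ ρ) (ℤS.⟦ e′ ⟧ ρ)) (cong₂ ℚ._+_ (ι-⟦⟧ e ρ) (ι-⟦⟧ e′ ρ))
  ι-⟦⟧ (e Expression.⊗ e′) ρ =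
    trans (ι-* (ℤS.⟦ e ⟧ ρ) (ℤS.⟦ e′ ⟧ ρ)) (cong₂ ℚ._*_ (ι-⟦⟧ e ρ) (ι-⟦⟧ e′ ρ))
  ι-⟦⟧ (e ⊛ k) ρ = trans (ι-^ (ℤS.⟦ e ⟧ ρ) k) (cong (_^ℚ k) (ι-⟦⟧ e ρ))
  ι-⟦⟧ (⊝ e) ρ = trans (ι-neg (ℤS.⟦ e ⟧ ρ)) (cong ℚ.-_ (ι-⟦⟧ e ρ))

  ι⁴-formula : ∀ k m (f : ℤS.Form k m (Coords (ℤS.Term k m))) (qs : Vec 𝔼 k) (ys : Vec ℤ m) →
    let ρ = ℤS.flatten qs ys ; E = ℤS.instantiate k m f in
    map⁴ ι (ℤS.eval E ρ) ≡ map⁴ (λ e → ℚ⟦ e ⟧ (map ι ρ)) E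
  ι⁴-formula k m f qs ys with ℤS.instantiate k m f
  ... | ⟨ a , b , c , d ⟩ = cong₄ ⟨_,_,_,_⟩ (ι-⟦⟧ a ρ) (ι-⟦⟧ b ρ) (ι-⟦⟧ c ρ) (ι-⟦⟧ d ρ)
    where ρ = ℤS.flatten qs ys

ι⁴ : 𝔼 → Coords ℚ
ι⁴ = map⁴ ι

ι⁴-· : ∀ X Y → ι⁴ (X · Y) ≡ ι⁴ X Q.· ι⁴ Y
ι⁴-· X Y = ι⁴-formula 2 0 (λ X Y → X E.· Y) (X ∷ Y ∷ []) []

ι⁴-bar : ∀ X → ι⁴ (bar X) ≡ Q.bar (ι⁴ X)
ι⁴-bar X = ι⁴-formula 1 0 E.bar (X ∷ []) []

ι⁴-∙ : ∀ n X → ι⁴ (n ∙ X) ≡ ι n Q.∙ ι⁴ X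
ι⁴-∙ n X = ι⁴-formula 1 1 (λ X n → n E.∙ X) (X ∷ []) (n ∷ [])

ι⁴-real-⊹ : ∀ h X → ι⁴ (real h ⊹ X) ≡ Q.real (ι h) Q.⊹ ι⁴ X
ι⁴-real-⊹ h X = ι⁴-formula 1 1 (λ X h → E.real h E.⊹ X) (X ∷ []) (h ∷ [])

ι⁴-fromHamilton : ∀ Z → ι⁴ (fromHamilton Z) ≡ Q.fromHamilton (ι⁴ Z)
ι⁴-fromHamilton Z = ι⁴-formula 1 0 E.fromHamilton (Z ∷ []) []

ι⁴-fromHamilton-⊹-ω : ∀ Z → ι⁴ (fromHamilton Z ⊹ ω) ≡ Q.fromHamilton (ι⁴ Z) Q.⊹ Q.ω
ι⁴-fromHamilton-⊹-ω Z = ι⁴-formula 1 0 (λ Z → E.fromHamilton Z E.⊹ E.ω) (Z ∷ []) []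

ι-nrm : ∀ X → ι (nrm X) ≡ Q.nrm (ι⁴ X)
ι-nrm X = ι-⟦⟧ (ℤS.instantiate 1 0 E.nrm) (ℤS.flatten (X ∷ []) [])

toHamilton-· : ∀ x y → Q.toHamilton ½ (x Q.· y) ≡ Q.toHamilton ½ x Q.⋆ Q.toHamilton ½ y
toHamilton-· x y = ℚS.solve 2 0
  (λ x y → Eℚ.toHamilton (Κ ½) (x Eℚ.· y) , Eℚ.toHamilton (Κ ½) x Eℚ.⋆ Eℚ.toHamilton (Κ ½) y)
  (x ∷ y ∷ []) [] refl

toHamilton-bar : ∀ x → Q.toHamilton ½ (Q.bar x) ≡ Q.conjᴴ (Q.toHamilton ½ x)
toHamilton-bar x = ℚS.solve 1 0
  (λ x → Eℚ.toHamilton (Κ ½) (Eℚ.bar x) , Eℚ.conjᴴ (Eℚ.toHamilton (Κ ½) x)) (x ∷ []) [] refl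

toHamilton-∙ : ∀ s x → Q.toHamilton ½ (s Q.∙ x) ≡ s Q.∙ Q.toHamilton ½ x
toHamilton-∙ s x = ℚS.solve 1 1
  (λ x s → Eℚ.toHamilton (Κ ½) (s Eℚ.∙ x) , s Eℚ.∙ Eℚ.toHamilton (Κ ½) x) (x ∷ []) (s ∷ []) refl

toHamilton-real-⊹ : ∀ s x →
  Q.toHamilton ½ (Q.real s Q.⊹ x) ≡ ⟨ s , 0ℚ , 0ℚ , 0ℚ ⟩ Q.⊹ Q.toHamilton ½ x
toHamilton-real-⊹ s x = ℚS.solve 1 1
  (λ x s → Eℚ.toHamilton (Κ ½) (Eℚ.real s Eℚ.⊹ x) ,
           ⟨ s , Eℚ.0# , Eℚ.0# , Eℚ.0# ⟩ Eℚ.⊹ Eℚ.toHamilton (Κ ½) x) (x ∷ []) (s ∷ []) refl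

normᴴ-toHamilton : ∀ x → Q.normᴴ (Q.toHamilton ½ x) ≡ Q.nrm x
normᴴ-toHamilton x = ℚS.solve₁ 1 0 (λ x → Eℚ.normᴴ (Eℚ.toHamilton (Κ ½) x) , Eℚ.nrm x)
  (x ∷ []) [] refl

fromHamilton-toHamilton : ∀ x → Q.fromHamilton (Q.toHamilton ½ x) ≡ x
fromHamilton-toHamilton x = ℚS.solve 1 0 (λ x → Eℚ.fromHamilton (Eℚ.toHamilton (Κ ½) x) , x)
  (x ∷ []) [] refl

toHamilton-fromHamilton : ∀ x → Q.toHamilton ½ (Q.fromHamilton x) ≡ x
toHamilton-fromHamilton x = ℚS.solve 1 0 (λ x → Eℚ.toHamilton (Κ ½) (Eℚ.fromHamilton x) , x)
  (x ∷ []) [] refl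

toHamilton-fromHamilton-⊹-ω : ∀ x →
  Q.toHamilton ½ (Q.fromHamilton x Q.⊹ Q.ω) ≡ x Q.⊹ ⟨ ½ , ½ , ½ , ½ ⟩
toHamilton-fromHamilton-⊹-ω x = ℚS.solve 1 0
  (λ x → Eℚ.toHamilton (Κ ½) (Eℚ.fromHamilton x Eℚ.⊹ Eℚ.ω) , x Eℚ.⊹ ⟨ Κ ½ , Κ ½ , Κ ½ , Κ ½ ⟩)
  (x ∷ []) [] refl

⋆-∙ : ∀ s x y → x Q.⋆ (s Q.∙ y) ≡ s Q.∙ (x Q.⋆ y)
⋆-∙ s x y = ℚS.solve 2 1 (λ x y s → x Eℚ.⋆ (s Eℚ.∙ y) , s Eℚ.∙ (x Eℚ.⋆ y))
  (x ∷ y ∷ []) (s ∷ []) refl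

∙-∙ : ∀ r s x → r Q.∙ (s Q.∙ x) ≡ (r ℚ.* s) Q.∙ x
∙-∙ r s x = ℚS.solve 1 2 (λ x r s → r Eℚ.∙ (s Eℚ.∙ x) , (r Eℚ.* s) Eℚ.∙ x)
  (x ∷ []) (r ∷ s ∷ []) refl

1∙ : ∀ x → 1ℚ Q.∙ x ≡ x
1∙ x = ℚS.solve 1 0 (λ x → Eℚ.1# Eℚ.∙ x , x) (x ∷ []) [] refl

-- The Hurwitz order inside the rational quaternions

toQuat : Coords ℚ → Quat
toQuat ⟨ a , b , c , d ⟩ = quat a b c d

fromQuat : Quat → Coords ℚ
fromQuat q = ⟨ re q , ii q , jj q , kk q ⟩

emb : 𝔼 → Quat
emb X = toQuat (Q.toHamilton ½ (ι⁴ X))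

emb-· : ∀ X Y → emb (X · Y) ≡ emb X ⊗ emb Y
emb-· X Y = trans (cong (λ x → toQuat (Q.toHamilton ½ x)) (ι⁴-· X Y))
                  (cong toQuat (toHamilton-· (ι⁴ X) (ι⁴ Y)))

emb-bar : ∀ X → emb (bar X) ≡ conj (emb X)
emb-bar X = trans (cong (λ x → toQuat (Q.toHamilton ½ x)) (ι⁴-bar X))
                  (cong toQuat (toHamilton-bar (ι⁴ X)))

emb-∙ : ∀ n X → emb (n ∙ X) ≡ scale (ι n) (emb X)
emb-∙ n X = trans (cong (λ x → toQuat (Q.toHamilton ½ x)) (ι⁴-∙ n X))
                  (cong toQuat (toHamilton-∙ (ι n) (ι⁴ X)))

emb-real-⊹ : ∀ h X → emb (real h ⊹ X) ≡ ofℤ h ⊕ emb X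
emb-real-⊹ h X = trans (cong (λ x → toQuat (Q.toHamilton ½ x)) (ι⁴-real-⊹ h X))
                       (cong toQuat (toHamilton-real-⊹ (ι h) (ι⁴ X)))

norm-emb : ∀ X → norm (emb X) ≡ ι (nrm X)
norm-emb X = trans (normᴴ-toHamilton (ι⁴ X)) (sym (ι-nrm X))

emb-injective : ∀ {X Y} → emb X ≡ emb Y → X ≡ Y
emb-injective {X} {Y} embX≡embY = cong₄ ⟨_,_,_,_⟩
  (ι-injective (cong c₀ ιX≡ιY)) (ι-injective (cong c₁ ιX≡ιY))
  (ι-injective (cong c₂ ιX≡ιY)) (ι-injective (cong c₃ ιX≡ιY))
  where
  ιX≡ιY : ι⁴ X ≡ ι⁴ Y
  ιX≡ιY = trans (sym (fromHamilton-toHamilton (ι⁴ X)))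
            (trans (cong (λ q → Q.fromHamilton (fromQuat q)) embX≡embY) (fromHamilton-toHamilton (ι⁴ Y)))

emb-fromHamilton : ∀ Z → emb (fromHamilton Z) ≡ toQuat (ι⁴ Z)
emb-fromHamilton Z = trans (cong (λ x → toQuat (Q.toHamilton ½ x)) (ι⁴-fromHamilton Z))
                           (cong toQuat (toHamilton-fromHamilton (ι⁴ Z)))

emb-fromHamilton-⊹-ω : ∀ Z → emb (fromHamilton Z ⊹ ω) ≡ toQuat (ι⁴ Z Q.⊹ ⟨ ½ , ½ , ½ , ½ ⟩)
emb-fromHamilton-⊹-ω Z = trans (cong (λ x → toQuat (Q.toHamilton ½ x)) (ι⁴-fromHamilton-⊹-ω Z))
                               (cong toQuat (toHamilton-fromHamilton-⊹-ω (ι⁴ Z)))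

-- Integral coordinates (a, b, c, d) with respect to 1, i, j, k give the ω-coordinates
-- (2a, b - a, c - a, d - a); adding ω gives the half-integral ones.
hurwitz-parity : ∀ X → (∃ λ Z → X ≡ fromHamilton Z) ⊎ (∃ λ Z → X ≡ fromHamilton Z ⊹ ω)
hurwitz-parity ⟨ a , b , c , d ⟩ with a ℤ.%ℕ 2 | n%ℕd<d a 2 | a≡a%ℕn+[a/ℕn]*n a 2
... | 0 | _ | a≡2k = inj₁ (Z , trans (cong ⟨_, b , c , d ⟩ a≡2k) (ℤS.solve 0 4
  (λ k b c d → ⟨ E.0# E.+ k E.* E.two , b , c , d ⟩ ,
               E.fromHamilton ⟨ k , k E.+ b , k E.+ c , k E.+ d ⟩)
  [] (k ∷ b ∷ c ∷ d ∷ []) refl))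
  where
  k = a ℤ./ℕ 2
  Z = ⟨ k , k + b , k + c , k + d ⟩
... | 1 | _ | a≡2k+1 = inj₂ (Z , trans (cong ⟨_, b , c , d ⟩ a≡2k+1) (ℤS.solve 0 4
  (λ k b c d → ⟨ E.1# E.+ k E.* E.two , b , c , d ⟩ ,
               E.fromHamilton ⟨ k , k E.+ b , k E.+ c , k E.+ d ⟩ E.⊹ E.ω)
  [] (k ∷ b ∷ c ∷ d ∷ []) refl))
  where
  k = a ℤ./ℕ 2
  Z = ⟨ k , k + b , k + c , k + d ⟩
... | ℕ.suc (ℕ.suc _) | ℕ.s≤s (ℕ.s≤s ()) | _

emb-isHurwitz : ∀ X → IsHurwitz (emb X)
emb-isHurwitz X with hurwitz-parity X
... | inj₁ (Z@(⟨ z₀ , z₁ , z₂ , z₃ ⟩) , refl) = subst IsHurwitz (sym (emb-fromHamilton Z))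
  (inj₁ ((z₀ , refl) , (z₁ , refl) , (z₂ , refl) , (z₃ , refl)))
... | inj₂ (Z@(⟨ z₀ , z₁ , z₂ , z₃ ⟩) , refl) = subst IsHurwitz (sym (emb-fromHamilton-⊹-ω Z))
  (inj₂ ((z₀ , add-sub (ι z₀)) , (z₁ , add-sub (ι z₁)) , (z₂ , add-sub (ι z₂)) , (z₃ , add-sub (ι z₃))))
  where
  add-sub : ∀ x → x ℚ.+ ½ ℚ.- ½ ≡ x
  add-sub = RingSolver.solve-∀ ℚ-ring

hurwitz-coordinates : ∀ {q} → IsHurwitz q → ∃ λ X → emb X ≡ q
hurwitz-coordinates (inj₁ ((z₀ , x₀≡z₀) , (z₁ , x₁≡z₁) , (z₂ , x₂≡z₂) , (z₃ , x₃≡z₃))) =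
  fromHamilton ⟨ z₀ , z₁ , z₂ , z₃ ⟩ ,
  trans (emb-fromHamilton ⟨ z₀ , z₁ , z₂ , z₃ ⟩) (sym (cong₄ quat x₀≡z₀ x₁≡z₁ x₂≡z₂ x₃≡z₃))
hurwitz-coordinates (inj₂ ((z₀ , x₀≡z₀) , (z₁ , x₁≡z₁) , (z₂ , x₂≡z₂) , (z₃ , x₃≡z₃))) =
  fromHamilton ⟨ z₀ , z₁ , z₂ , z₃ ⟩ ⊹ ω ,
  trans (emb-fromHamilton-⊹-ω ⟨ z₀ , z₁ , z₂ , z₃ ⟩)
        (sym (cong₄ quat (sub-add x₀≡z₀) (sub-add x₁≡z₁) (sub-add x₂≡z₂) (sub-add x₃≡z₃)))
  where
  sub-add : ∀ {x y} → x ℚ.- ½ ≡ y → x ≡ y ℚ.+ ½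
  sub-add {x} x-½≡y = trans (identity x) (cong (ℚ._+ ½) x-½≡y)
    where
    identity : ∀ x → x ≡ x ℚ.- ½ ℚ.+ ½
    identity = RingSolver.solve-∀ ℚ-ring

⊗-scale : ∀ r x y → x ⊗ scale r y ≡ scale r (x ⊗ y)
⊗-scale r x y = cong toQuat (⋆-∙ r (fromQuat x) (fromQuat y))

scale-inverse : ∀ {r s} → r ℚ.* s ≡ 1ℚ → ∀ x → scale r (scale s x) ≡ x
scale-inverse {r} {s} rs≡1 x = cong toQuat
  (trans (∙-∙ r s (fromQuat x)) (trans (cong (Q._∙ fromQuat x) rs≡1) (1∙ (fromQuat x))))

inv≡scale-conj : ∀ q (nz : norm q ≢ 0ℚ) → inv q ≡ scale ((1/ norm q) {{≢-nonZero nz}}) (conj q)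
inv≡scale-conj q nz with norm q ℚ.≟ 0ℚ
... | yes q≡0 = contradiction q≡0 nz
... | no _ = refl

emb-conjugate : ∀ P B (nz : norm (emb P) ≢ 0ℚ) →
  emb P ⊗ emb B ⊗ inv (emb P) ≡ scale ((1/ norm (emb P)) {{≢-nonZero nz}}) (emb (P · B · bar P))
emb-conjugate P B nz = begin
  emb P ⊗ emb B ⊗ inv (emb P)              ≡⟨ cong (emb P ⊗ emb B ⊗_) (inv≡scale-conj (emb P) nz) ⟩
  emb P ⊗ emb B ⊗ scale r (conj (emb P))   ≡⟨ ⊗-scale r (emb P ⊗ emb B) (conj (emb P)) ⟩
  scale r (emb P ⊗ emb B ⊗ conj (emb P))   ≡⟨ cong (scale r) (cong₂ _⊗_ (emb-· P B) (emb-bar P)) ⟨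
  scale r (emb (P · B) ⊗ emb (bar P))      ≡⟨ cong (scale r) (emb-· (P · B) (bar P)) ⟨
  scale r (emb (P · B · bar P))            ∎
  where
  open ≡-Reasoning
  r = (1/ norm (emb P)) {{≢-nonZero nz}}

isHurwitz-scale⇔ : ∀ {r} n M → r ℚ.* ι n ≡ 1ℚ → IsHurwitz (scale r (emb M)) ⇔ (∃ λ G → M ≡ n ∙ G)
isHurwitz-scale⇔ {r} n M rn≡1 = mk⇔ to from
  where
  open ≡-Reasoning
  nr≡1 : ι n ℚ.* r ≡ 1ℚ
  nr≡1 = trans (ℚ.*-comm (ι n) r) rn≡1
  to : IsHurwitz (scale r (emb M)) → ∃ λ G → M ≡ n ∙ G
  to H with hurwitz-coordinates H
  ... | G , embG≡ = G , emb-injective (begin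
    emb M                          ≡⟨ scale-inverse {ι n} {r} nr≡1 (emb M) ⟨
    scale (ι n) (scale r (emb M))  ≡⟨ cong (scale (ι n)) embG≡ ⟨
    scale (ι n) (emb G)            ≡⟨ emb-∙ n G ⟨
    emb (n ∙ G)                    ∎)
  from : (∃ λ G → M ≡ n ∙ G) → IsHurwitz (scale r (emb M))
  from (G , refl) = subst IsHurwitz
    (sym (trans (cong (scale r) (emb-∙ n G)) (scale-inverse {r} {ι n} rn≡1 (emb G)))) (emb-isHurwitz G)

isHurwitz-conjugate⇔ : ∀ {n} .{{_ : ℕ.NonZero n}} P B → norm (emb P) ≡ ι (+ n) →
  IsHurwitz (emb P ⊗ emb B ⊗ inv (emb P)) ⇔ (∃ λ G → P · B · bar P ≡ + n ∙ G)
isHurwitz-conjugate⇔ {n} P B N≡n =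
  subst (λ q → IsHurwitz q ⇔ (∃ λ G → P · B · bar P ≡ + n ∙ G)) (sym (emb-conjugate P B nz))
    (isHurwitz-scale⇔ {1/ norm (emb P)} (+ n) (P · B · bar P) rn≡1)
  where
  nz : norm (emb P) ≢ 0ℚ
  nz N≡0 = ℕ.≢-nonZero⁻¹ n (ℤ.+-injective (ι-injective {+ n} {0ℤ} (trans (sym N≡n) N≡0)))
  instance _ = ≢-nonZero nz
  rn≡1 : 1/ norm (emb P) ℚ.* ι (+ n) ≡ 1ℚ
  rn≡1 = subst (λ x → 1/ norm (emb P) ℚ.* x ≡ 1ℚ) N≡n (ℚ.*-inverseˡ (norm (emb P)))

left-divisor⇔ : ∀ P B →
  (∃ λ h → ∃ λ τ → IsHurwitz τ × (ofℤ h ⊕ emb B ≡ conj (emb P) ⊗ τ)) ⇔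
  (∃ λ h → ∃ λ T → real h ⊹ B ≡ bar P · T)
left-divisor⇔ P B = mk⇔ to from
  where
  emb-bar-· : ∀ T → emb (bar P · T) ≡ conj (emb P) ⊗ emb T
  emb-bar-· T = trans (emb-· (bar P) T) (cong (_⊗ emb T) (emb-bar P))
  to : (∃ λ h → ∃ λ τ → IsHurwitz τ × (ofℤ h ⊕ emb B ≡ conj (emb P) ⊗ τ)) →
       ∃ λ h → ∃ λ T → real h ⊹ B ≡ bar P · T
  to (h , τ , τ∈𝔼 , h+β≡π̄τ) with hurwitz-coordinates τ∈𝔼
  ... | T , refl = h , T , emb-injective (trans (emb-real-⊹ h B) (trans h+β≡π̄τ (sym (emb-bar-· T))))
  from : (∃ λ h → ∃ λ T → real h ⊹ B ≡ bar P · T) →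
         ∃ λ h → ∃ λ τ → IsHurwitz τ × (ofℤ h ⊕ emb B ≡ conj (emb P) ⊗ τ)
  from (h , T , h+B≡P̄T) = h , emb T , emb-isHurwitz T ,
    trans (sym (emb-real-⊹ h B)) (trans (cong emb h+B≡P̄T) (emb-bar-· T))


lemma4p5 : (π β : Quat) → IsHurwitz π → IsHurwitz β → Pure β →
    (p : ℕ) → Prime p → p > 2 → norm π ≡ (+ p) / 1 →
    (IsHurwitz (π ⊗ β ⊗ inv π) ⇔
      (∃ λ (h : ℤ) → ∃ λ (τ : Quat) → IsHurwitz τ × (ofℤ h ⊕ β ≡ conj π ⊗ τ)))
lemma4p5 π β π∈𝔼 β∈𝔼 _ p p-prime 2<p N≡p
  with hurwitz-coordinates π∈𝔼 | hurwitz-coordinates β∈𝔼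
... | P , refl | B , refl =
  ⇔.trans (isHurwitz-conjugate⇔ P B N≡p)
    (⇔.trans (divisible-conjugate⇔left-divisor P B p-prime 2<p nrmP≡p) (⇔.sym (left-divisor⇔ P B)))
  where
  instance _ = prime⇒nonZero p-prime
  nrmP≡p : nrm P ≡ + p
  nrmP≡p = ι-injective (trans (sym (norm-emb P)) N≡p)
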